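{- Let $t\ge 2$ and $m\ge 2$ be integers. The derived graph $(T_{4t};m)$ of the voltage tree $T_{4t}$ over $\mathbb{Z}_m$ has girth $4t$.
   Context: Voltage graphs and derived graphs: a voltage graph over $\mathbb{Z}_m$ is a finite directed multigraph with arc labels in $\mathbb{Z}_m$ (unlabelled edges have label $0$), some degree-$1$ vertices being pinned. In the derived graph each non-pinned vertex $v$ gives $v^0,\dots,v^{m-1}$, each pinned vertex $v^{*}$ gives one vertex; an arc $v\to w$ labelled $a$ between non-pinned vertices gives edges $v^iw^{i+a}$ (indices mod $m$); an edge $v^{*}w$ with $v^{*}$ pinned gives edges $v^{*}w^i$ for all $i$. For $s\ge1$ the tree $Y_s$: a pinned vertex $y^{*}$ adjacent to $y$, and a complete binary tree rooted at $y$ with vertices $y_b$, $b$ a bit string of length $\le 2s-1$ (children of $y_b$ are $y_{b0},y_{b1}$); delete $y_{0^{s}}$ and all its descendants; write $y_{a}$ with $a=0^{s-1}$ (so $y_a=y$ when $s=1$). $Z_s$ is an identical copy with $y$ replaced by $z$. The tree $X'_t$: a pinned vertex $x^{*}$ adjacent to $x$, and a complete binary tree rooted at $x$ with vertices $x_b$, $|b|\le 2t-2$; with $a=0^{t-1}$, delete all proper descendants of $x_a$ (so $x_a$ is a leaf at distance $t$ from $x^{*}$). $T_{4t}$ is obtained from $X'_t$, $Y_{t-1}$, $Z_{t-1}$ by adding the edges $x_{0^{t-1}}y_{0^{t-2}}$ and $x_{0^{t-1}}z_{0^{t-2}}$; all edges have label $0$, and $x^{*},y^{*},z^{*}$ are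 pinned. -}

module Defs where

open import Data.Nat using (ℕ; zero; suc; _+_; _*_; _∸_; _≤_; _≤ᵇ_; _<ᵇ_; NonZero)
open import Data.Nat.DivMod using (_%_; m%n<n)
open import Data.Fin using (Fin; toℕ; fromℕ<; inject₁; fromℕ) renaming (zero to fzero; suc to fsuc)
open import Data.Bool using (Bool; true; false; T; not; _∧_)
open import Data.List using (List; []; _∷_; _++_; [_]; length; replicate)
open import Data.Product using (Σ; _×_; _,_; ∃)
open import Data.Sum using (_⊎_)
open import Relation.Binary.PropositionalEquality using (_≡_)
open import Function.Definitions using (Injective)

-- Voltage graphs over ℤ_m.  Labels are natural-number representatives
-- of elements of ℤ_m (interpreted mod m in the derived graph).

record VoltageGraph : Set₁ where
  field
    V      : Set
    pinned : V → Bool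
    Arc    : V → V → Set
    label  : ∀ {v w} → Arc v w → ℕ

addMod : ∀ {m} → Fin m → ℕ → Fin m
addMod {suc n} i a = fromℕ< (m%n<n (toℕ i + a) (suc n))

module Derived (G : VoltageGraph) (m : ℕ) where
  open VoltageGraph G

  data DV : Set where
    lift : (v : V) → T (not (pinned v)) → Fin m → DV
    pin  : (v : V) → T (pinned v) → DV

  data DArc : DV → DV → Set where
    both : ∀ {v w} (e : Arc v w) (pv : T (not (pinned v))) (pw : T (not (pinned w)))
           (i : Fin m) → DArc (lift v pv i) (lift w pw (addMod i (label e)))
    pinL : ∀ {v w} (e : Arc v w) (pv : T (pinned v)) (pw : T (not (pinned w)))
           (i : Fin m) → DArc (pin v pv) (lift w pw i)
    pinR : ∀ {v w} (e : Arc v w) (pv : T (not (pinned v))) (pw : T (pinned w))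
           (i : Fin m) → DArc (lift v pv i) (pin w pw)

  Adj : DV → DV → Set
  Adj a b = DArc a b ⊎ DArc b a

IsCycle : {D : Set} → (D → D → Set) → (n : ℕ) → (Fin (suc n) → D) → Set
IsCycle Adj n f =
  Injective _≡_ _≡_ f
  × (∀ (i : Fin n) → Adj (f (inject₁ i)) (f (fsuc i)))
  × Adj (f (fromℕ n)) (f fzero)

HasCycleOfLength : {D : Set} → (D → D → Set) → ℕ → Set
HasCycleOfLength Adj zero = Data.Empty.⊥ where import Data.Empty
HasCycleOfLength {D} Adj (suc n) =
  (3 ≤ suc n) × Σ (Fin (suc n) → D) (IsCycle Adj n)

HasGirth : {D : Set} → (D → D → Set) → ℕ → Set
HasGirth Adj g = HasCycleOfLength Adj g × (∀ k → HasCycleOfLength Adj k → g ≤ k)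

zeros : ℕ → List Bool
zeros k = replicate k false

prefix? : List Bool → List Bool → Bool
prefix? [] _ = true
prefix? (_ ∷ _) [] = false
prefix? (true ∷ as) (true ∷ bs) = prefix? as bs
prefix? (false ∷ as) (false ∷ bs) = prefix? as bs
prefix? (true ∷ _) (false ∷ _) = false
prefix? (false ∷ _) (true ∷ _) = false

-- x_b is a (non-pinned) vertex of X'_t : |b| ≤ 2t-2, b not a proper
-- descendant of x_{0^{t-1}}
inX : ℕ → List Bool → Bool
inX t b = (length b ≤ᵇ (2 * t ∸ 2))
        ∧ not (prefix? (zeros (t ∸ 1)) b ∧ ((t ∸ 1) <ᵇ length b))

-- y_b is a (non-pinned) vertex of Y_s : |b| ≤ 2s-1, and b is not
-- y_{0^s} or one of its descendants
inY : ℕ → List Bool → Bool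
inY s b = (length b ≤ᵇ (2 * s ∸ 1)) ∧ not (prefix? (zeros s) b)

data Node : Set where
  x* y* z* : Node
  X Y Z : List Bool → Node

validT : ℕ → Node → Bool
validT t x* = true
validT t y* = true
validT t z* = true
validT t (X b) = inX t b
validT t (Y b) = inY (t ∸ 1) b
validT t (Z b) = inY (t ∸ 1) b

pinnedN : Node → Bool
pinnedN x* = true
pinnedN y* = true
pinnedN z* = true
pinnedN (X _) = false
pinnedN (Y _) = false
pinnedN (Z _) = false

-- edges of T_{4t} (orientation immaterial; all labels are 0)
data ArcN (t : ℕ) : Node → Node → Set where
  px : ArcN t x* (X [])
  py : ArcN t y* (Y [])
  pz : ArcN t z* (Z [])
  tx : ∀ b c → ArcN t (X b) (X (b ++ [ c ]))
  ty : ∀ b c → ArcN t (Y b) (Y (b ++ [ c ]))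
  tz : ∀ b c → ArcN t (Z b) (Z (b ++ [ c ]))
  xy : ArcN t (X (zeros (t ∸ 1))) (Y (zeros (t ∸ 2)))
  xz : ArcN t (X (zeros (t ∸ 1))) (Z (zeros (t ∸ 2)))

VT : ℕ → Set
VT t = Σ Node (λ n → T (validT t n))

T4t : ℕ → VoltageGraph
T4t t = record
  { V      = VT t
  ; pinned = λ { (n , _) → pinnedN n }
  ; Arc    = λ { (n , _) (n' , _) → ArcN t n n' }
  ; label  = λ _ → 0
  }

-- The cycle: walk from x* to y* along their geodesic of length 2t in copy 0 and come back in
-- copy 1; the two halves meet only in the pinned end vertices.
--
-- The bound: as all voltages are 0, an edge between unpinned vertices of (T_{4t};m) stays in
-- one copy and lies over an edge of T_{4t}.  Hence a cycle meets a pinned vertex (at a vertex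
-- farthest from x* both cycle neighbours would be the lift of its parent in the same copy),
-- and even a second one (otherwise the rest of the cycle stays in one copy, so both cycle
-- neighbours of the pinned vertex are the same lift of its only neighbour).  Distinct pinned
-- vertices are 2t apart in T_{4t}, and a 1-Lipschitz function that changes by 2t along a
-- closed walk forces the walk to have length at least 4t.
module Submission where

open import Defs
open import Data.Nat
open import Data.Nat.Properties
open import Data.Nat.DivMod
open import Data.Nat.Solver using (module +-*-Solver)
open import Data.Bool using (Bool; true; false; T; not; if_then_else_)
open import Data.Bool.Properties using (T?; T-irrelevant; T-∧; ∧-zeroʳ)
open import Data.Unit using (tt)
open import Data.Empty using (⊥; ⊥-elim)
open import Data.Fin using (Fin; toℕ; fromℕ<; inject₁; fromℕ) renaming (zero to fzero; suc to fsuc)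
open import Data.Fin.Properties using (toℕ-fromℕ<; toℕ-injective; toℕ<n; toℕ-inject₁; toℕ-fromℕ)
open import Data.List using (List; []; _∷_; _++_; [_]; length; allFin)
open import Data.List.Properties using (length-++; length-replicate)
open import Data.List.Extrema.Nat using (argmax; f[xs]≤f[argmax])
open import Data.List.Membership.Propositional.Properties using (∈-allFin)
import Data.List.Relation.Unary.All as All
open import Data.Product using (Σ; ∃-syntax; _×_; _,_; proj₁; proj₂)
open import Data.Sum using (_⊎_; inj₁; inj₂; [_,_]′; swap) renaming (map to ⊎-map)
open import Function using (_∘_)
open import Function.Bundles using (Equivalence)
open import Relation.Nullary using (¬_; Dec; yes; no)
open import Relation.Binary.PropositionalEquality hiding ([_])

-- Lipschitz sequences and cycles

∣suc-n-n∣≡1 : ∀ n → ∣ suc n - n ∣ ≡ 1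
∣suc-n-n∣≡1 zero = refl
∣suc-n-n∣≡1 (suc n) = ∣suc-n-n∣≡1 n

m≡1+n⊎n≡1+m⇒∣m-n∣≡1 : ∀ {m n} → m ≡ suc n ⊎ n ≡ suc m → ∣ m - n ∣ ≡ 1
m≡1+n⊎n≡1+m⇒∣m-n∣≡1 {n = n} (inj₁ refl) = ∣suc-n-n∣≡1 n
m≡1+n⊎n≡1+m⇒∣m-n∣≡1 {m} (inj₂ refl) = trans (∣-∣-comm m (suc m)) (∣suc-n-n∣≡1 m)

∣m-n∣≡1⇒m≢n : ∀ {m n} → ∣ m - n ∣ ≡ 1 → m ≢ n
∣m-n∣≡1⇒m≢n {m} e refl = 0≢1+n (trans (sym (∣n-n∣≡0 m)) e)

[r+d]%n≢r : ∀ r d n .{{_ : NonZero n}} → r < n → 0 < d → d < n → (r + d) % n ≢ r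
[r+d]%n≢r r (suc d) n r<n _ d<n eq with r + suc d <? n
... | yes r+d<n = m+1+n≢m r (trans (sym (m<n⇒m%n≡m r+d<n)) eq)
... | no r+d≮n = <⇒≢ d<n (+-cancelˡ-≡ r (suc d) n (begin
    r + suc d           ≡⟨ m∸n+n≡m n≤r+d ⟨
    (r + suc d ∸ n) + n ≡⟨ cong (_+ n) wrapped ⟩
    r + n               ∎))
  where
  open ≡-Reasoning
  n≤r+d : n ≤ r + suc d
  n≤r+d = ≮⇒≥ r+d≮n
  wrapped : r + suc d ∸ n ≡ r
  wrapped = trans (sym (m<n⇒m%n≡m (m<n+o⇒m∸n<o (r + suc d) n (+-mono-< r<n d<n))))
                  (trans (m≤n⇒[n∸m]%m≡n%m n≤r+d) eq)

[m+d]%n≢m%n : ∀ m d n .{{_ : NonZero n}} → 0 < d → d < n → (m + d) % n ≢ m % n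
[m+d]%n≢m%n m d n 0<d d<n eq = [r+d]%n≢r (m % n) d n (m%n<n m n) 0<d d<n (begin
  (m % n + d) % n ≡⟨ cong (λ x → (m % n + x) % n) (m<n⇒m%n≡m d<n) ⟨
  (m % n + d % n) % n ≡⟨ %-distribˡ-+ m d n ⟨
  (m + d) % n ≡⟨ eq ⟩
  m % n ∎)
  where open ≡-Reasoning

suc-% : ∀ k n .{{_ : NonZero n}} → suc k % n ≡ suc (k % n) % n
suc-% k n = trans (cong (λ x → suc x % n) (m≡m%n+[m/n]*n k n)) ([m+kn]%n≡m%n (suc (k % n)) (k / n) n)

module _ (h : ℕ → ℕ) (step : ∀ k → ∣ h (suc k) - h k ∣ ≤ 1) where

  ∣h[i+d]-h[i]∣≤d : ∀ i d → ∣ h (i + d) - h i ∣ ≤ d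
  ∣h[i+d]-h[i]∣≤d i zero =
    ≤-reflexive (trans (cong (λ j → ∣ h j - h i ∣) (+-identityʳ i)) (∣n-n∣≡0 (h i)))
  ∣h[i+d]-h[i]∣≤d i (suc d) = begin
    ∣ h (i + suc d) - h i ∣
      ≡⟨ cong (λ j → ∣ h j - h i ∣) (+-suc i d) ⟩
    ∣ h (suc (i + d)) - h i ∣
      ≤⟨ ∣-∣-triangle (h (suc (i + d))) (h (i + d)) (h i) ⟩
    ∣ h (suc (i + d)) - h (i + d) ∣ + ∣ h (i + d) - h i ∣
      ≤⟨ +-mono-≤ (step (i + d)) (∣h[i+d]-h[i]∣≤d i d) ⟩
    suc d
      ∎
    where open ≤-Reasoning

  twice-∣h[i]-h[i+d]∣≤d+e : ∀ i d e → h (i + d + e) ≡ h i → 2 * ∣ h i - h (i + d) ∣ ≤ d + e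
  twice-∣h[i]-h[i+d]∣≤d+e i d e closed = begin
    2 * ∣ h i - h (i + d) ∣                    ≡⟨ cong (∣ h i - h (i + d) ∣ +_) (+-identityʳ _) ⟩
    ∣ h i - h (i + d) ∣ + ∣ h i - h (i + d) ∣  ≤⟨ +-mono-≤ out back ⟩
    d + e                                      ∎
    where
    open ≤-Reasoning
    out : ∣ h i - h (i + d) ∣ ≤ d
    out = subst (_≤ d) (∣-∣-comm (h (i + d)) (h i)) (∣h[i+d]-h[i]∣≤d i d)
    back : ∣ h i - h (i + d) ∣ ≤ e
    back = subst (λ x → ∣ x - h (i + d) ∣ ≤ e) closed (∣h[i+d]-h[i]∣≤d (i + d) e)

module CycleWalk {D : Set} {Adj : D → D → Set} {n : ℕ} {f : Fin (suc n) → D}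
                 (cycle : IsCycle Adj n f) where

  walk : ℕ → D
  walk k = f (k mod suc n)

  walk-≡ : ∀ k {i : Fin (suc n)} → k % suc n ≡ toℕ i → walk k ≡ f i
  walk-≡ k e = cong f (toℕ-injective (trans (toℕ-fromℕ< _) e))

  walk-toℕ : ∀ i → walk (toℕ i) ≡ f i
  walk-toℕ i = walk-≡ (toℕ i) (m<n⇒m%n≡m (toℕ<n i))

  walk-% : ∀ k → walk (k % suc n) ≡ walk k
  walk-% k = walk-≡ (k % suc n) (trans (m%n%n≡m%n k (suc n)) (sym (toℕ-fromℕ< _)))

  walk-periodic : ∀ k → walk (k + suc n) ≡ walk k
  walk-periodic k = walk-≡ (k + suc n) (trans ([m+n]%n≡m%n k (suc n)) (sym (toℕ-fromℕ< _)))

  walk-injective : ∀ {i j} → walk i ≡ walk j → i % suc n ≡ j % suc n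
  walk-injective e = trans (sym (toℕ-fromℕ< _)) (trans (cong toℕ (proj₁ cycle e)) (toℕ-fromℕ< _))

  walk-adj : ∀ k → Adj (walk k) (walk (suc k))
  walk-adj k with k % suc n <? n | m%n<n k (suc n)
  ... | yes r<n | _ =
    subst₂ Adj (sym (walk-≡ k here)) (sym (walk-≡ (suc k) next)) (proj₁ (proj₂ cycle) (fromℕ< r<n))
    where
    here : k % suc n ≡ toℕ (inject₁ (fromℕ< r<n))
    here = sym (trans (toℕ-inject₁ _) (toℕ-fromℕ< r<n))
    next : suc k % suc n ≡ toℕ (fsuc (fromℕ< r<n))
    next = trans (suc-% k (suc n)) (trans (m<n⇒m%n≡m (s≤s r<n)) (cong suc (sym (toℕ-fromℕ< r<n))))
  ... | no r≮n | r<1+n =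
    subst₂ Adj (sym (walk-≡ k here)) (sym (walk-≡ (suc k) next)) (proj₂ (proj₂ cycle))
    where
    r≡n : k % suc n ≡ n
    r≡n = ≤-antisym (s≤s⁻¹ r<1+n) (≮⇒≥ r≮n)
    here : k % suc n ≡ toℕ (fromℕ n)
    here = trans r≡n (sym (toℕ-fromℕ n))
    next : suc k % suc n ≡ toℕ (fzero {n})
    next = trans (suc-% k (suc n)) (trans (cong (λ x → suc x % suc n) r≡n) (n%n≡0 (suc n)))

  walk-adj-pred : ∀ k → Adj (walk (k + n)) (walk k)
  walk-adj-pred k =
    subst (Adj (walk (k + n))) (trans (cong walk (sym (+-suc k n))) (walk-periodic k)) (walk-adj (k + n))

  walk-neighbours-distinct : 2 ≤ n → ∀ k → walk (suc k) ≢ walk (k + n)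
  walk-neighbours-distinct (s≤s (s≤s {n = n′} _)) k e =
    [m+d]%n≢m%n (suc k) (suc n′) (suc n) (s≤s z≤n) (s≤s (n≤1+n _))
      (trans (cong (_% suc n) (sym (+-suc k (suc n′)))) (sym (walk-injective {suc k} {k + n} e)))

  module _ (h : D → ℕ) where

    twice-∣-∣≤length : (∀ {a b} → Adj a b → ∣ h a - h b ∣ ≤ 1) →
                       ∀ i j → 2 * ∣ h (walk i) - h (walk j) ∣ ≤ suc n
    twice-∣-∣≤length lipschitz i j = [ forward , backward ]′ (≤-total (i % suc n) (j % suc n))
      where
      step : ∀ k → ∣ h (walk (suc k)) - h (walk k) ∣ ≤ 1
      step k = subst (_≤ 1) (∣-∣-comm (h (walk k)) _) (lipschitz (walk-adj k))
      ordered : ∀ {a b} → a ≤ b → b < suc n → 2 * ∣ h (walk a) - h (walk b) ∣ ≤ suc n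
      ordered {a} {b} a≤b b<1+n = subst₂ (λ x y → 2 * ∣ h (walk a) - h (walk x) ∣ ≤ y)
          (m+[n∸m]≡n a≤b) d+e≡1+n (twice-∣h[i]-h[i+d]∣≤d+e (h ∘ walk) step a d (suc n ∸ d) closed)
        where
        d : ℕ
        d = b ∸ a
        d+e≡1+n : d + (suc n ∸ d) ≡ suc n
        d+e≡1+n = m+[n∸m]≡n (≤-trans (m∸n≤m b a) (<⇒≤ b<1+n))
        closed : h (walk (a + d + (suc n ∸ d))) ≡ h (walk a)
        closed = cong h (trans (cong walk (trans (+-assoc a d _) (cong (a +_) d+e≡1+n))) (walk-periodic a))
      residues : ∀ x y → 2 * ∣ h (walk (x % suc n)) - h (walk (y % suc n)) ∣ ≤ suc n →
                 2 * ∣ h (walk x) - h (walk y) ∣ ≤ suc n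
      residues x y = subst₂ (λ u v → 2 * ∣ h u - h v ∣ ≤ suc n) (walk-% x) (walk-% y)
      forward : i % suc n ≤ j % suc n → 2 * ∣ h (walk i) - h (walk j) ∣ ≤ suc n
      forward i≤j = residues i j (ordered i≤j (m%n<n j (suc n)))
      backward : j % suc n ≤ i % suc n → 2 * ∣ h (walk i) - h (walk j) ∣ ≤ suc n
      backward j≤i = subst (_≤ suc n) (cong (2 *_) (∣-∣-comm (h (walk j)) (h (walk i))))
                       (residues j i (ordered j≤i (m%n<n i (suc n))))

    peak : (∀ {a b} → Adj a b → ∣ h a - h b ∣ ≡ 1) →
           Σ ℕ λ k → h (walk (suc k)) < h (walk k) × h (walk (k + n)) < h (walk k)
    peak unit = k , lower (suc k) (subst (_≡ 1) (∣-∣-comm (h (walk k)) _) (unit (walk-adj k)))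
                  , lower (k + n) (unit (walk-adj-pred k))
      where
      top : Fin (suc n)
      top = argmax (h ∘ f) fzero (allFin (suc n))
      k : ℕ
      k = toℕ top
      highest : ∀ j → h (walk j) ≤ h (walk k)
      highest j = subst (h (walk j) ≤_) (cong h (sym (walk-toℕ top)))
                    (All.lookup (f[xs]≤f[argmax] {f = h ∘ f} fzero (allFin (suc n))) (∈-allFin (j mod suc n)))
      lower : ∀ j → ∣ h (walk j) - h (walk k) ∣ ≡ 1 → h (walk j) < h (walk k)
      lower j unit-step = ≤∧≢⇒< (highest j) (∣m-n∣≡1⇒m≢n unit-step)

-- Derived graphs of voltage graphs with zero voltages

¬T⇒T-not : ∀ {b} → ¬ T b → T (not b)
¬T⇒T-not {false} _ = tt
¬T⇒T-not {true} ¬b = ⊥-elim (¬b tt)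

T-not⇒¬T : ∀ {b} → T (not b) → ¬ T b
T-not⇒¬T {false} _ ()

addMod-0 : ∀ {m} (i : Fin m) → addMod i 0 ≡ i
addMod-0 {suc m} i = toℕ-injective (trans (toℕ-fromℕ< _)
  (trans (cong (_% suc m) (+-identityʳ (toℕ i))) (m<n⇒m%n≡m (toℕ<n i))))

closed-walk-cycle : ∀ {D : Set} {Adj : D → D → Set} n (w : ℕ → D) →
                    (∀ k → k ≤ n → Adj (w k) (w (suc k))) → w (suc n) ≡ w 0 →
                    (∀ i j → i ≤ n → j ≤ n → w i ≡ w j → i ≡ j) → IsCycle Adj n (w ∘ toℕ)
closed-walk-cycle {Adj = Adj} n w adj closes injective =
  (λ {i} {j} e → toℕ-injective (injective (toℕ i) (toℕ j) (s≤s⁻¹ (toℕ<n i)) (s≤s⁻¹ (toℕ<n j)) e)) ,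
  (λ i → subst (λ x → Adj (w x) (w (suc (toℕ i)))) (sym (toℕ-inject₁ i))
                (adj (toℕ i) (<⇒≤ (toℕ<n i)))) ,
  subst (λ x → Adj (w x) (w 0)) (sym (toℕ-fromℕ n)) (subst (Adj (w n)) closes (adj n ≤-refl))

module Underlying (G : VoltageGraph) where
  open VoltageGraph G

  Edge : V → V → Set
  Edge v w = Arc v w ⊎ Arc w v

  UnitSteps : (V → ℕ) → Set
  UnitSteps h = ∀ v w → Arc v w → ∣ h v - h w ∣ ≡ 1

  OneLipschitz : (V → ℕ) → Set
  OneLipschitz h = ∀ v w → Arc v w → ∣ h v - h w ∣ ≤ 1

  unit-steps⇒one-lipschitz : ∀ h → UnitSteps h → OneLipschitz h
  unit-steps⇒one-lipschitz h unit v w = ≤-reflexive ∘ unit v w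

  UniqueDescent : (V → ℕ) → Set
  UniqueDescent h = ∀ v w w′ → Edge v w → Edge v w′ → h w < h v → h w′ < h v → w ≡ w′

  record Separation (d : ℕ) (p q : V) : Set where
    field
      gauge           : V → ℕ
      gauge-lipschitz : OneLipschitz gauge
      gauge-apart     : d ≤ ∣ gauge p - gauge q ∣

  PinnedAreLeaves : Set
  PinnedAreLeaves = ∀ v w w′ → T (pinned v) → Edge v w → Edge v w′ → w ≡ w′

  record PinnedPath (ℓ : ℕ) : Set where
    field
      vertex         : ℕ → V
      start-pinned   : T (pinned (vertex 0))
      end-pinned     : T (pinned (vertex ℓ))
      inner-unpinned : ∀ {k} → 0 < k → k < ℓ → ¬ T (pinned (vertex k))
      edge           : ∀ {k} → k < ℓ → Edge (vertex k) (vertex (suc k))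
      injective      : ∀ {i j} → i ≤ ℓ → j ≤ ℓ → vertex i ≡ vertex j → i ≡ j

module ZeroVoltage (G : VoltageGraph) (m : ℕ)
                   (zero-labels : ∀ {v w} (e : VoltageGraph.Arc G v w) → VoltageGraph.label G e ≡ 0) where
  open VoltageGraph G
  open Derived G m using (lift; pin; both; pinL; pinR)
  open Underlying G

  DV : Set
  DV = Derived.DV G m

  DArc Adj : DV → DV → Set
  DArc = Derived.DArc G m
  Adj = Derived.Adj G m

  node : DV → V
  node (lift v _ _) = v
  node (pin v _) = v

  -- pinned vertices get the junk copy index 0
  copy : DV → ℕ
  copy (lift _ _ i) = toℕ i
  copy (pin _ _) = 0

  Pinnedᴰ : DV → Set
  Pinnedᴰ a = T (pinned (node a))

  darc-arc : ∀ {a b} → DArc a b → Arc (node a) (node b)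
  darc-arc (both e _ _ _) = e
  darc-arc (pinL e _ _ _) = e
  darc-arc (pinR e _ _ _) = e

  adj-edge : ∀ {a b} → Adj a b → Edge (node a) (node b)
  adj-edge = ⊎-map darc-arc darc-arc

  adj-∣-∣ : ∀ (h : V → ℕ) (R : ℕ → Set) → (∀ v w → Arc v w → R ∣ h v - h w ∣) →
            ∀ {a b} → Adj a b → R ∣ h (node a) - h (node b) ∣
  adj-∣-∣ h R bound {a} {b} ad =
    [ bound _ _ , (λ e → subst R (∣-∣-comm (h (node b)) (h (node a))) (bound _ _ e)) ]′ (adj-edge ad)

  darc-copy : ∀ {a b} → DArc a b → ¬ Pinnedᴰ a → ¬ Pinnedᴰ b → copy a ≡ copy b
  darc-copy (both e _ _ i) _ _ = cong toℕ (sym (trans (cong (addMod i) (zero-labels e)) (addMod-0 i)))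
  darc-copy (pinL _ pv _ _) ¬pa _ = ⊥-elim (¬pa pv)
  darc-copy (pinR _ _ pw _) _ ¬pb = ⊥-elim (¬pb pw)

  adj-copy : ∀ {a b} → Adj a b → ¬ Pinnedᴰ a → ¬ Pinnedᴰ b → copy a ≡ copy b
  adj-copy (inj₁ d) ¬pa ¬pb = darc-copy d ¬pa ¬pb
  adj-copy (inj₂ d) ¬pa ¬pb = sym (darc-copy d ¬pb ¬pa)

  pinned-copy : ∀ {a} → Pinnedᴰ a → copy a ≡ 0
  pinned-copy {lift _ p _} q = ⊥-elim (T-not⇒¬T p q)
  pinned-copy {pin _ _} _ = refl

  DV-≡ : ∀ {a b} → node a ≡ node b → copy a ≡ copy b → a ≡ b
  DV-≡ {lift v p i} {lift .v p′ i′} refl e rewrite T-irrelevant p p′ | toℕ-injective e = refl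
  DV-≡ {lift v p _} {pin .v p′} refl _ = ⊥-elim (T-not⇒¬T p p′)
  DV-≡ {pin v p} {lift .v p′ _} refl _ = ⊥-elim (T-not⇒¬T p′ p)
  DV-≡ {pin v p} {pin .v p′} refl _ rewrite T-irrelevant p p′ = refl

  pinned-≡ : ∀ {a b} → Pinnedᴰ a → node a ≡ node b → a ≡ b
  pinned-≡ {a} {b} pa same =
    DV-≡ {a} {b} same (trans (pinned-copy {a} pa) (sym (pinned-copy {b} (subst (T ∘ pinned) same pa))))

  unpinned-neighbours-≡ : ∀ {a u u′} → ¬ Pinnedᴰ a → Adj a u → Adj a u′ → node u ≡ node u′ → u ≡ u′
  unpinned-neighbours-≡ {u = u} {u′} ¬pa au au′ same = by-pinnedness (T? (pinned (node u)))
    where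
    by-pinnedness : Dec (T (pinned (node u))) → u ≡ u′
    by-pinnedness (yes pu) = pinned-≡ pu same
    by-pinnedness (no ¬pu) = DV-≡ {u} {u′} same (trans (sym (adj-copy au ¬pa ¬pu))
                                             (adj-copy au′ ¬pa (¬pu ∘ subst (T ∘ pinned) (sym same))))

  pinned-or-same-copy : (w : ℕ → DV) → (∀ k → Adj (w k) (w (suc k))) → ∀ a d →
                        (∃[ e ] e ≤ d × Pinnedᴰ (w (a + e))) ⊎ copy (w (a + d)) ≡ copy (w a)
  pinned-or-same-copy w adj a zero = inj₂ (cong (copy ∘ w) (+-identityʳ a))
  pinned-or-same-copy w adj a (suc d) = extend (pinned-or-same-copy w adj a d)
    where
    Result : ℕ → Set
    Result d = (∃[ e ] e ≤ d × Pinnedᴰ (w (a + e))) ⊎ copy (w (a + d)) ≡ copy (w a)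
    step : Adj (w (a + d)) (w (a + suc d))
    step = subst (Adj (w (a + d)) ∘ w) (sym (+-suc a d)) (adj (a + d))
    same-or-pinned : copy (w (a + d)) ≡ copy (w a) →
                     Dec (Pinnedᴰ (w (a + d))) → Dec (Pinnedᴰ (w (a + suc d))) → Result (suc d)
    same-or-pinned _ (yes p) _ = inj₁ (d , n≤1+n d , p)
    same-or-pinned _ (no _) (yes q) = inj₁ (suc d , ≤-refl , q)
    same-or-pinned same (no ¬p) (no ¬q) = inj₂ (trans (sym (adj-copy step ¬p ¬q)) same)
    extend : Result d → Result (suc d)
    extend (inj₁ (e , e≤d , p)) = inj₁ (e , m≤n⇒m≤1+n e≤d , p)
    extend (inj₂ same) = same-or-pinned same (T? (pinned (node (w (a + d))))) (T? (pinned (node (w (a + suc d)))))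

  module _ {n} {f : Fin (suc n) → DV} (cycle : IsCycle Adj n f) where
    open CycleWalk {Adj = Adj} cycle

    cycle-meets-pinned : 2 ≤ n → ∀ h → UnitSteps h → UniqueDescent h → ∃[ k ] Pinnedᴰ (walk k)
    cycle-meets-pinned n≥2 h unit unique = at-peak (peak (h ∘ node) (adj-∣-∣ h (_≡ 1) unit))
      where
      at-peak : Σ ℕ (λ k → h (node (walk (suc k))) < h (node (walk k))
                         × h (node (walk (k + n))) < h (node (walk k))) →
                ∃[ k ] Pinnedᴰ (walk k)
      at-peak (k , succ-lower , pred-lower) = by-pinnedness (T? (pinned (node (walk k))))
        where
        by-pinnedness : Dec (Pinnedᴰ (walk k)) → ∃[ k ] Pinnedᴰ (walk k)
        by-pinnedness (yes p) = k , p
        by-pinnedness (no ¬p) = ⊥-elim (walk-neighbours-distinct n≥2 k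
          (unpinned-neighbours-≡ ¬p (walk-adj k) (swap (walk-adj-pred k))
            (unique _ _ _ (adj-edge (walk-adj k)) (adj-edge (swap (walk-adj-pred k))) succ-lower pred-lower)))

    cycle-meets-another-pinned : 2 ≤ n → PinnedAreLeaves → ∀ k → Pinnedᴰ (walk k) →
                                 ∃[ j ] Pinnedᴰ (walk j) × walk j ≢ walk k
    cycle-meets-another-pinned n≥2@(s≤s (s≤s {n = n″} _)) leaf k pk =
      [ another , ⊥-elim ∘ same-copy-impossible ]′ (pinned-or-same-copy walk walk-adj (suc k) (suc n″))
      where
      another : ∃[ e ] e ≤ suc n″ × Pinnedᴰ (walk (suc k + e)) →
                ∃[ j ] Pinnedᴰ (walk j) × walk j ≢ walk k
      another (e , e≤ , p) = suc k + e , p , λ same →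
        [m+d]%n≢m%n k (suc e) (suc n) (s≤s z≤n) (s≤s (s≤s e≤))
          (trans (cong (_% suc n) (+-suc k e)) (walk-injective {suc k + e} {k} same))
      same-copy-impossible : copy (walk (suc k + suc n″)) ≡ copy (walk (suc k)) → ⊥
      same-copy-impossible same-copy = walk-neighbours-distinct n≥2 k (DV-≡ {walk (suc k)} {walk (k + n)}
        (leaf _ _ _ pk (adj-edge (walk-adj k)) (adj-edge (swap (walk-adj-pred k))))
        (sym (trans (cong (copy ∘ walk) (+-suc k (suc n″))) same-copy)))

  girth-≥ : ∀ h → UnitSteps h → UniqueDescent h → PinnedAreLeaves → ∀ d →
            (∀ {p q} → T (pinned p) → T (pinned q) → p ≢ q → Separation d p q) →
            ∀ k → HasCycleOfLength Adj k → 2 * d ≤ k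
  girth-≥ h unit unique leaf d separated (suc n) (3≤1+n , f , cycle) =
    through-pinned (cycle-meets-pinned cycle n≥2 h unit unique)
    where
    open CycleWalk {Adj = Adj} cycle
    n≥2 : 2 ≤ n
    n≥2 = s≤s⁻¹ 3≤1+n
    through-two-pinned : ∀ i → Pinnedᴰ (walk i) → ∃[ j ] Pinnedᴰ (walk j) × walk j ≢ walk i →
                         2 * d ≤ suc n
    through-two-pinned i pi (j , pj , j≢i) = ≤-trans (*-monoʳ-≤ 2 gauge-apart)
      (twice-∣-∣≤length (gauge ∘ node) (adj-∣-∣ gauge (_≤ 1) gauge-lipschitz) i j)
      where open Separation (separated pi pj (λ same → j≢i (pinned-≡ {walk j} {walk i} pj (sym same))))
    through-pinned : ∃[ i ] Pinnedᴰ (walk i) → 2 * d ≤ suc n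
    through-pinned (i , pi) = through-two-pinned i pi (cycle-meets-another-pinned cycle n≥2 leaf i pi)

  lift-at : Fin m → V → DV
  lift-at c v with T? (pinned v)
  ... | yes p = pin v p
  ... | no ¬p = lift v (¬T⇒T-not ¬p) c

  node-lift-at : ∀ c v → node (lift-at c v) ≡ v
  node-lift-at c v with T? (pinned v)
  ... | yes _ = refl
  ... | no _ = refl

  lift-at-copy : ∀ c {v} → ¬ T (pinned v) → copy (lift-at c v) ≡ toℕ c
  lift-at-copy c {v} ¬p with T? (pinned v)
  ... | yes p = ⊥-elim (¬p p)
  ... | no _ = refl

  lift-at-pinned : ∀ c c′ {v} → T (pinned v) → lift-at c v ≡ lift-at c′ v
  lift-at-pinned c c′ {v} p with T? (pinned v)
  ... | yes _ = refl
  ... | no ¬p = ⊥-elim (¬p p)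

  lift-at-arc : ∀ c {v w} → Arc v w → ¬ T (pinned v) ⊎ ¬ T (pinned w) → Adj (lift-at c v) (lift-at c w)
  lift-at-arc c {v} {w} e unpinned with T? (pinned v) | T? (pinned w)
  ... | yes p | yes q = ⊥-elim ([ (λ ¬p → ¬p p) , (λ ¬q → ¬q q) ]′ unpinned)
  ... | yes p | no _ = inj₁ (pinL e p _ c)
  ... | no _ | yes q = inj₁ (pinR e _ q c)
  ... | no _ | no _ = inj₁ (subst (λ i → DArc (lift v _ c) (lift w _ i))
                                 (trans (cong (addMod c) (zero-labels e)) (addMod-0 c)) (both e _ _ c))

  lift-at-edge : ∀ c {v w} → Edge v w → ¬ T (pinned v) ⊎ ¬ T (pinned w) → Adj (lift-at c v) (lift-at c w)
  lift-at-edge c (inj₁ e) unpinned = lift-at-arc c e unpinned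
  lift-at-edge c (inj₂ e) unpinned = swap (lift-at-arc c e (swap unpinned))

  module PathCycle {ℓ} (2≤ℓ : 2 ≤ ℓ) (c₀ c₁ : Fin m) (c₀≢c₁ : c₀ ≢ c₁) (path : PinnedPath ℓ) where
    open PinnedPath path

    around : ℕ → DV
    around k with k ≤? ℓ
    ... | yes _ = lift-at c₀ (vertex k)
    ... | no _ = lift-at c₁ (vertex (ℓ + ℓ ∸ k))

    around-out : ∀ {k} → k ≤ ℓ → around k ≡ lift-at c₀ (vertex k)
    around-out {k} k≤ℓ with k ≤? ℓ
    ... | yes _ = refl
    ... | no k≰ℓ = ⊥-elim (k≰ℓ k≤ℓ)

    around-back : ∀ {j} → j ≤ ℓ → around (ℓ + j) ≡ lift-at c₁ (vertex (ℓ ∸ j))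
    around-back {zero} _ = trans (around-out (≤-reflexive (+-identityʳ ℓ)))
      (trans (cong (lift-at c₀ ∘ vertex) (+-identityʳ ℓ)) (lift-at-pinned c₀ c₁ end-pinned))
    around-back {suc j} _ with ℓ + suc j ≤? ℓ
    ... | yes ℓ+1+j≤ℓ = ⊥-elim (m+1+n≰m ℓ ℓ+1+j≤ℓ)
    ... | no _ = cong (lift-at c₁ ∘ vertex) ([m+n]∸[m+o]≡n∸o ℓ ℓ (suc j))

    step-unpinned : ∀ {k} → k < ℓ → ¬ T (pinned (vertex k)) ⊎ ¬ T (pinned (vertex (suc k)))
    step-unpinned {zero} _ = inj₂ (inner-unpinned (s≤s z≤n) 2≤ℓ)
    step-unpinned {suc _} k<ℓ = inj₁ (inner-unpinned (s≤s z≤n) k<ℓ)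

    path-adj : ∀ c {k} → k < ℓ → Adj (lift-at c (vertex k)) (lift-at c (vertex (suc k)))
    path-adj c k<ℓ = lift-at-edge c (edge k<ℓ) (step-unpinned k<ℓ)

    around-adj : ∀ {k} → k < ℓ + ℓ → Adj (around k) (around (suc k))
    around-adj {k} k<2ℓ = by-side (k <? ℓ)
      where
      by-side : Dec (k < ℓ) → Adj (around k) (around (suc k))
      by-side (yes k<ℓ) =
        subst₂ Adj (sym (around-out (<⇒≤ k<ℓ))) (sym (around-out k<ℓ)) (path-adj c₀ k<ℓ)
      by-side (no k≮ℓ) = subst₂ Adj (sym back₀) (sym back₁) (swap (path-adj c₁ i<ℓ))
        where
        j : ℕ
        j = k ∸ ℓ
        ℓ+j≡k : ℓ + j ≡ k
        ℓ+j≡k = m+[n∸m]≡n (≮⇒≥ k≮ℓ)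
        j<ℓ : j < ℓ
        j<ℓ = +-cancelˡ-< ℓ j ℓ (subst (_< ℓ + ℓ) (sym ℓ+j≡k) k<2ℓ)
        i : ℕ
        i = ℓ ∸ suc j
        ℓ∸j≡1+i : ℓ ∸ j ≡ suc i
        ℓ∸j≡1+i = +-∸-assoc 1 j<ℓ
        i<ℓ : i < ℓ
        i<ℓ = subst (_≤ ℓ) ℓ∸j≡1+i (m∸n≤m ℓ j)
        back₀ : around k ≡ lift-at c₁ (vertex (suc i))
        back₀ = trans (cong around (sym ℓ+j≡k))
                  (trans (around-back (<⇒≤ j<ℓ)) (cong (lift-at c₁ ∘ vertex) ℓ∸j≡1+i))
        back₁ : around (suc k) ≡ lift-at c₁ (vertex i)
        back₁ = trans (cong around (trans (cong suc (sym ℓ+j≡k)) (sym (+-suc ℓ j)))) (around-back j<ℓ)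

    around-closes : around (ℓ + ℓ) ≡ around 0
    around-closes = trans (around-back ≤-refl) (trans (cong (lift-at c₁ ∘ vertex) (n∸n≡0 ℓ))
                      (trans (lift-at-pinned c₁ c₀ start-pinned) (sym (around-out z≤n))))

    side : ∀ k → k < ℓ + ℓ → k ≤ ℓ ⊎ ∃[ j ] (0 < j × j < ℓ × ℓ + j ≡ k)
    side k k<2ℓ with k ≤? ℓ
    ... | yes k≤ℓ = inj₁ k≤ℓ
    ... | no k≰ℓ =
      inj₂ (k ∸ ℓ , m<n⇒0<n∸m ℓ<k , +-cancelˡ-< ℓ _ ℓ (subst (_< ℓ + ℓ) (sym ℓ+j≡k) k<2ℓ) , ℓ+j≡k)
      where
      ℓ<k : ℓ < k
      ℓ<k = ≰⇒> k≰ℓ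
      ℓ+j≡k : ℓ + (k ∸ ℓ) ≡ k
      ℓ+j≡k = m+[n∸m]≡n (<⇒≤ ℓ<k)

    same-vertex : ∀ {c c′ v w} → lift-at c v ≡ lift-at c′ w → v ≡ w
    same-vertex {c} {c′} {v} {w} e = trans (sym (node-lift-at c v)) (trans (cong node e) (node-lift-at c′ w))

    crossing : ∀ {a j} → a ≤ ℓ → 0 < j → j < ℓ → around a ≢ around (ℓ + j)
    crossing {a} {j} a≤ℓ 0<j j<ℓ e = c₀≢c₁ (toℕ-injective (begin
      toℕ c₀                              ≡⟨ sym (lift-at-copy c₀ inner-a) ⟩
      copy (lift-at c₀ (vertex a))        ≡⟨ cong copy lifts ⟩
      copy (lift-at c₁ (vertex (ℓ ∸ j)))  ≡⟨ lift-at-copy c₁ inner ⟩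
      toℕ c₁                              ∎))
      where
      open ≡-Reasoning
      lifts : lift-at c₀ (vertex a) ≡ lift-at c₁ (vertex (ℓ ∸ j))
      lifts = trans (sym (around-out a≤ℓ)) (trans e (around-back (<⇒≤ j<ℓ)))
      inner : ¬ T (pinned (vertex (ℓ ∸ j)))
      inner = inner-unpinned (m<n⇒0<n∸m j<ℓ) (∸-monoʳ-< 0<j (<⇒≤ j<ℓ))
      inner-a : ¬ T (pinned (vertex a))
      inner-a = subst (¬_ ∘ T ∘ pinned ∘ vertex) (sym (injective a≤ℓ (m∸n≤m ℓ j) (same-vertex lifts))) inner

    around-injective : ∀ {a b} → a < ℓ + ℓ → b < ℓ + ℓ → around a ≡ around b → a ≡ b
    around-injective {a} {b} a<2ℓ b<2ℓ e with side a a<2ℓ | side b b<2ℓ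
    ... | inj₁ a≤ℓ | inj₁ b≤ℓ =
          injective a≤ℓ b≤ℓ (same-vertex (trans (sym (around-out a≤ℓ)) (trans e (around-out b≤ℓ))))
    ... | inj₁ a≤ℓ | inj₂ (j , 0<j , j<ℓ , refl) = ⊥-elim (crossing a≤ℓ 0<j j<ℓ e)
    ... | inj₂ (i , 0<i , i<ℓ , refl) | inj₁ b≤ℓ = ⊥-elim (crossing b≤ℓ 0<i i<ℓ (sym e))
    ... | inj₂ (i , _ , i<ℓ , refl) | inj₂ (j , _ , j<ℓ , refl) =
          cong (ℓ +_) (∸-cancelˡ-≡ (<⇒≤ i<ℓ) (<⇒≤ j<ℓ) (injective (m∸n≤m ℓ i) (m∸n≤m ℓ j)
            (same-vertex (trans (sym (around-back (<⇒≤ i<ℓ))) (trans e (around-back (<⇒≤ j<ℓ)))))))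

  pinned-path-cycle : ∀ {ℓ} → 2 ≤ ℓ → (c₀ c₁ : Fin m) → c₀ ≢ c₁ → PinnedPath ℓ →
                      HasCycleOfLength Adj (ℓ + ℓ)
  pinned-path-cycle {suc (suc ℓ′)} 2≤ℓ@(s≤s (s≤s z≤n)) c₀ c₁ c₀≢c₁ path =
    s≤s (s≤s (≤-trans (s≤s z≤n) (m≤n+m (suc (suc ℓ′)) ℓ′))) , around ∘ toℕ ,
    closed-walk-cycle {Adj = Adj} _ around (λ k k≤ → around-adj (s≤s k≤)) around-closes
      (λ i j i≤ j≤ → around-injective (s≤s i≤) (s≤s j≤))
    where open PathCycle 2≤ℓ c₀ c₁ c₀≢c₁ path

-- The voltage tree T_{4t}

dropLast : List Bool → List Bool
dropLast [] = []
dropLast (_ ∷ []) = []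
dropLast (c ∷ c′ ∷ b) = c ∷ dropLast (c′ ∷ b)

dropLast-snoc : ∀ b c → dropLast (b ++ [ c ]) ≡ b
dropLast-snoc [] c = refl
dropLast-snoc (c′ ∷ []) c = refl
dropLast-snoc (c′ ∷ c″ ∷ b) c = cong (c′ ∷_) (dropLast-snoc (c″ ∷ b) c)

length-snoc : ∀ (b : List Bool) c → length (b ++ [ c ]) ≡ suc (length b)
length-snoc b c = trans (length-++ b) (+-comm (length b) 1)

zeros-snoc : ∀ k → zeros k ++ [ false ] ≡ zeros (suc k)
zeros-snoc zero = refl
zeros-snoc (suc k) = cong (false ∷_) (zeros-snoc k)

-- In the infinite binary tree of bit strings: whether b is 0^k, the distance
-- from b to 0^k, and the neighbour of b on the way to 0^k.
isZeros : ℕ → List Bool → Bool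
isZeros zero [] = true
isZeros zero (_ ∷ _) = false
isZeros (suc k) [] = false
isZeros (suc k) (false ∷ b) = isZeros k b
isZeros (suc k) (true ∷ b) = false

dist₀ : ℕ → List Bool → ℕ
dist₀ k [] = k
dist₀ zero (_ ∷ b) = suc (length b)
dist₀ (suc k) (false ∷ b) = dist₀ k b
dist₀ (suc k) (true ∷ b) = suc k + suc (length b)

toward₀ : ℕ → List Bool → List Bool
toward₀ zero b = dropLast b
toward₀ (suc k) [] = false ∷ []
toward₀ (suc k) (false ∷ b) = false ∷ toward₀ k b
toward₀ (suc k) (true ∷ b) = dropLast (true ∷ b)

isZeros-zeros : ∀ k → isZeros k (zeros k) ≡ true
isZeros-zeros zero = refl
isZeros-zeros (suc k) = isZeros-zeros k

dist₀-zeros : ∀ j r → dist₀ (j + r) (zeros j) ≡ r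
dist₀-zeros zero r = refl
dist₀-zeros (suc j) r = dist₀-zeros j r

dist₀-zeros-self : ∀ k → dist₀ k (zeros k) ≡ 0
dist₀-zeros-self zero = refl
dist₀-zeros-self (suc k) = dist₀-zeros-self k

Toward : ℕ → List Bool → List Bool → Set
Toward k u v = isZeros k u ≡ false × toward₀ k u ≡ v × dist₀ k u ≡ suc (dist₀ k v)

snoc-toward : ∀ k b c → Toward k (b ++ [ c ]) b ⊎ Toward k b (b ++ [ c ])
snoc-toward zero [] c = inj₁ (refl , refl , refl)
snoc-toward zero (c′ ∷ b) c = inj₁ (refl , dropLast-snoc (c′ ∷ b) c , cong suc (length-snoc b c))
snoc-toward (suc k) [] false = inj₂ (refl , refl , refl)
snoc-toward (suc k) [] true = inj₁ (refl , refl , +-comm (suc k) 1)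
snoc-toward (suc k) (false ∷ b) c with snoc-toward k b c
... | inj₁ (z , e , d) = inj₁ (z , cong (false ∷_) e , d)
... | inj₂ (z , e , d) = inj₂ (z , cong (false ∷_) e , d)
snoc-toward (suc k) (true ∷ b) c =
  inj₁ (refl , dropLast-snoc (true ∷ b) c ,
        trans (cong (λ l → suc k + suc l) (length-snoc b c)) (+-suc (suc k) (suc (length b))))

dist₀-snoc : ∀ k b c →
             dist₀ k (b ++ [ c ]) ≡ suc (dist₀ k b) ⊎ dist₀ k b ≡ suc (dist₀ k (b ++ [ c ]))
dist₀-snoc k b c with snoc-toward k b c
... | inj₁ (_ , _ , d) = inj₁ d
... | inj₂ (_ , _ , d) = inj₂ d

<ᵇ-false : ∀ {m n} → n ≤ m → (m <ᵇ n) ≡ false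
<ᵇ-false {m} {n} n≤m with m <ᵇ n in eq
... | false = refl
... | true = ⊥-elim (<⇒≱ (<ᵇ⇒< m n (subst T (sym eq) tt)) n≤m)

prefix-zeros-longer : ∀ k j → j ≤ k → prefix? (zeros (suc k)) (zeros j) ≡ false
prefix-zeros-longer k zero _ = refl
prefix-zeros-longer (suc k) (suc j) (s≤s j≤k) = prefix-zeros-longer k j j≤k

module VoltageTree (s : ℕ) where

  t : ℕ
  t = suc (suc s)

  -- distX and distY are the distances to x* and to y* in T_{4t}
  distX : Node → ℕ
  distX x* = 0
  distX y* = t + t
  distX z* = t + t
  distX (X b) = suc (length b)
  distX (Y b) = suc t + dist₀ s b
  distX (Z b) = suc t + dist₀ s b

  distY : Node → ℕ
  distY x* = t + t
  distY y* = 0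
  distY z* = t + t
  distY (X b) = t + dist₀ (suc s) b
  distY (Y b) = suc (length b)
  distY (Z b) = suc t + dist₀ s b

  parentX : List Bool → Node
  parentX [] = x*
  parentX (c ∷ b) = X (dropLast (c ∷ b))

  parentX-snoc : ∀ b c → parentX (b ++ [ c ]) ≡ X b
  parentX-snoc [] c = refl
  parentX-snoc (c′ ∷ b) c = cong X (dropLast-snoc (c′ ∷ b) c)

  -- the neighbour towards x* (x* itself gets the junk value x*)
  parent : Node → Node
  parent x* = x*
  parent y* = Y []
  parent z* = Z []
  parent (X b) = parentX b
  parent (Y b) = if isZeros s b then X (zeros (suc s)) else Y (toward₀ s b)
  parent (Z b) = if isZeros s b then X (zeros (suc s)) else Z (toward₀ s b)

  ParentEdge : Node → Node → Set
  ParentEdge u v = v ≡ parent u × distX u ≡ suc (distX v)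

  t+t≡2+t+s : t + t ≡ suc (suc t + s)
  t+t≡2+t+s = cong (λ n → suc (suc n)) (trans (+-suc s (suc s)) (cong suc (+-suc s s)))

  arc-parent : ∀ {n n′} → ArcN t n n′ → ParentEdge n n′ ⊎ ParentEdge n′ n
  arc-parent px = inj₂ (refl , refl)
  arc-parent py = inj₁ (refl , t+t≡2+t+s)
  arc-parent pz = inj₁ (refl , t+t≡2+t+s)
  arc-parent (tx b c) = inj₂ (sym (parentX-snoc b c) , cong suc (length-snoc b c))
  arc-parent (ty b c) with snoc-toward s b c
  ... | inj₁ (z , e , d) rewrite z | e = inj₂ (refl , trans (cong (suc t +_) d) (+-suc (suc t) _))
  ... | inj₂ (z , e , d) rewrite z | e = inj₁ (refl , trans (cong (suc t +_) d) (+-suc (suc t) _))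
  arc-parent (tz b c) with snoc-toward s b c
  ... | inj₁ (z , e , d) rewrite z | e = inj₂ (refl , trans (cong (suc t +_) d) (+-suc (suc t) _))
  ... | inj₂ (z , e , d) rewrite z | e = inj₁ (refl , trans (cong (suc t +_) d) (+-suc (suc t) _))
  arc-parent xy rewrite isZeros-zeros s | dist₀-zeros-self s | length-replicate s {false} =
    inj₂ (refl , +-identityʳ (suc t))
  arc-parent xz rewrite isZeros-zeros s | dist₀-zeros-self s | length-replicate s {false} =
    inj₂ (refl , +-identityʳ (suc t))

  distY-step : ∀ {n n′} → ArcN t n n′ → distY n′ ≡ suc (distY n) ⊎ distY n ≡ suc (distY n′)
  distY-step px = inj₂ (+-suc t (suc s))
  distY-step py = inj₁ refl
  distY-step pz = inj₂ t+t≡2+t+s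
  distY-step (tx b c) with dist₀-snoc (suc s) b c
  ... | inj₁ d = inj₁ (trans (cong (t +_) d) (+-suc t _))
  ... | inj₂ d = inj₂ (trans (cong (t +_) d) (+-suc t _))
  distY-step (ty b c) = inj₁ (cong suc (length-snoc b c))
  distY-step (tz b c) with dist₀-snoc s b c
  ... | inj₁ d = inj₁ (trans (cong (suc t +_) d) (+-suc (suc t) _))
  ... | inj₂ d = inj₂ (trans (cong (suc t +_) d) (+-suc (suc t) _))
  distY-step xy rewrite dist₀-zeros-self (suc s) | length-replicate s {false} = inj₂ (+-identityʳ t)
  distY-step xz rewrite dist₀-zeros-self s = inj₁ refl

  open Underlying (T4t t)

  distXᵛ distYᵛ : VT t → ℕ
  distXᵛ = distX ∘ proj₁
  distYᵛ = distY ∘ proj₁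

  VT-≡ : ∀ {v w : VT t} → proj₁ v ≡ proj₁ w → v ≡ w
  VT-≡ {n , p} {.n , q} refl = cong (n ,_) (T-irrelevant p q)

  distX-unit-steps : UnitSteps distXᵛ
  distX-unit-steps _ _ e with arc-parent e
  ... | inj₁ (_ , d) = m≡1+n⊎n≡1+m⇒∣m-n∣≡1 (inj₁ d)
  ... | inj₂ (_ , d) = m≡1+n⊎n≡1+m⇒∣m-n∣≡1 (inj₂ d)

  distY-unit-steps : UnitSteps distYᵛ
  distY-unit-steps _ _ e with distY-step e
  ... | inj₁ d = m≡1+n⊎n≡1+m⇒∣m-n∣≡1 (inj₂ d)
  ... | inj₂ d = m≡1+n⊎n≡1+m⇒∣m-n∣≡1 (inj₁ d)

  distX-one-lipschitz : OneLipschitz distXᵛ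
  distX-one-lipschitz = unit-steps⇒one-lipschitz distXᵛ distX-unit-steps

  distY-one-lipschitz : OneLipschitz distYᵛ
  distY-one-lipschitz = unit-steps⇒one-lipschitz distYᵛ distY-unit-steps

  lower-neighbour-is-parent : ∀ {n n′} → ArcN t n n′ ⊎ ArcN t n′ n → distX n′ < distX n → n′ ≡ parent n
  lower-neighbour-is-parent (inj₁ a) lower with arc-parent a
  ... | inj₁ (e , _) = e
  ... | inj₂ (_ , d) = ⊥-elim (<-asym lower (≤-reflexive (sym d)))
  lower-neighbour-is-parent (inj₂ a) lower with arc-parent a
  ... | inj₁ (_ , d) = ⊥-elim (<-asym lower (≤-reflexive (sym d)))
  ... | inj₂ (e , _) = e

  distX-unique-descent : UniqueDescent distXᵛ
  distX-unique-descent _ _ _ e e′ lower lower′ =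
    VT-≡ (trans (lower-neighbour-is-parent e lower) (sym (lower-neighbour-is-parent e′ lower′)))

  arc-from-pinned-unique : ∀ {n w w′} → T (pinnedN n) → ArcN t n w → ArcN t n w′ → w ≡ w′
  arc-from-pinned-unique _ px px = refl
  arc-from-pinned-unique _ py py = refl
  arc-from-pinned-unique _ pz pz = refl
  arc-from-pinned-unique () (tx _ _) _
  arc-from-pinned-unique () (ty _ _) _
  arc-from-pinned-unique () (tz _ _) _
  arc-from-pinned-unique () xy _
  arc-from-pinned-unique () xz _

  no-arc-into-pinned : ∀ {n w} → T (pinnedN n) → ¬ ArcN t w n
  no-arc-into-pinned () px
  no-arc-into-pinned () py
  no-arc-into-pinned () pz
  no-arc-into-pinned () (tx _ _)
  no-arc-into-pinned () (ty _ _)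
  no-arc-into-pinned () (tz _ _)
  no-arc-into-pinned () xy
  no-arc-into-pinned () xz

  pinned-are-leaves : PinnedAreLeaves
  pinned-are-leaves _ _ _ p (inj₁ a) (inj₁ a′) = VT-≡ (arc-from-pinned-unique p a a′)
  pinned-are-leaves _ _ _ p (inj₂ a) _ = ⊥-elim (no-arc-into-pinned p a)
  pinned-are-leaves _ _ _ p (inj₁ _) (inj₂ a) = ⊥-elim (no-arc-into-pinned p a)

  separated-by-distX : ∀ {p q} → t + t ≤ ∣ distXᵛ p - distXᵛ q ∣ → Separation (t + t) p q
  separated-by-distX apart = record
    { gauge = distXᵛ ; gauge-lipschitz = distX-one-lipschitz ; gauge-apart = apart }

  separated-by-distY : ∀ {p q} → t + t ≤ ∣ distYᵛ p - distYᵛ q ∣ → Separation (t + t) p q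
  separated-by-distY apart = record
    { gauge = distYᵛ ; gauge-lipschitz = distY-one-lipschitz ; gauge-apart = apart }

  pinned-separated : ∀ {p q : VT t} → T (pinnedN (proj₁ p)) → T (pinnedN (proj₁ q)) → p ≢ q →
                     Separation (t + t) p q
  pinned-separated {x* , _} {x* , _} _ _ p≢q = ⊥-elim (p≢q refl)
  pinned-separated {x* , _} {y* , _} _ _ _ = separated-by-distX ≤-refl
  pinned-separated {x* , _} {z* , _} _ _ _ = separated-by-distX ≤-refl
  pinned-separated {y* , _} {x* , _} _ _ _ = separated-by-distX ≤-refl
  pinned-separated {y* , _} {y* , _} _ _ p≢q = ⊥-elim (p≢q refl)
  pinned-separated {y* , _} {z* , _} _ _ _ = separated-by-distY ≤-refl
  pinned-separated {z* , _} {x* , _} _ _ _ = separated-by-distX ≤-refl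
  pinned-separated {z* , _} {y* , _} _ _ _ = separated-by-distY ≤-refl
  pinned-separated {z* , _} {z* , _} _ _ p≢q = ⊥-elim (p≢q refl)

  valid-X : ∀ {j} → j < t → T (validT t (X (zeros j)))
  valid-X {j} (s≤s j≤1+s)
    rewrite length-replicate j {false} | <ᵇ-false {suc s} {j} j≤1+s
          | ∧-zeroʳ (prefix? (zeros (suc s)) (zeros j)) =
    Equivalence.from T-∧ (≤⇒≤ᵇ j≤2t∸2 , tt)
    where
    j≤2t∸2 : j ≤ s + (t + 0)
    j≤2t∸2 = ≤-trans j≤1+s (≤-trans (n≤1+n (suc s)) (≤-trans (m≤m+n t 0) (m≤n+m (t + 0) s)))

  valid-Y : ∀ {j} → j ≤ s → T (validT t (Y (zeros j)))
  valid-Y {j} j≤s rewrite length-replicate j {false} | prefix-zeros-longer s j j≤s =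
    Equivalence.from T-∧ (≤⇒≤ᵇ (≤-trans j≤s (m≤m+n s _)) , tt)

  -- the geodesic x*, x_[], …, x_{0^{t-1}}, y_{0^{t-2}}, …, y_[], y* (then junk y*)
  xy-node : ℕ → Node
  xy-node zero = x*
  xy-node (suc j) with j <? t | j <? suc t + s
  ... | yes _ | _ = X (zeros j)
  ... | no _ | yes _ = Y (zeros (t + s ∸ j))
  ... | no _ | no _ = y*

  xy-valid : ∀ k → T (validT t (xy-node k))
  xy-valid zero = tt
  xy-valid (suc j) with j <? t | j <? suc t + s
  ... | yes j<t | _ = valid-X j<t
  ... | no j≮t | yes _ = valid-Y (subst (t + s ∸ j ≤_) (m+n∸m≡n t s) (∸-monoʳ-≤ (t + s) (≮⇒≥ j≮t)))
  ... | no _ | no _ = tt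

  xy-node-X : ∀ {j} → j < t → xy-node (suc j) ≡ X (zeros j)
  xy-node-X {j} j<t with j <? t
  ... | yes _ = refl
  ... | no j≮t = ⊥-elim (j≮t j<t)

  xy-node-Y : ∀ {i} → i ≤ s → xy-node (suc (t + i)) ≡ Y (zeros (s ∸ i))
  xy-node-Y {i} i≤s with t + i <? t | t + i <? suc t + s
  ... | yes t+i<t | _ = ⊥-elim (m+n≮m t i t+i<t)
  ... | no _ | yes _ = cong (Y ∘ zeros) ([m+n]∸[m+o]≡n∸o t s i)
  ... | no _ | no t+i≮1+t+s = ⊥-elim (t+i≮1+t+s (s≤s (+-monoʳ-≤ t i≤s)))

  xy-node-y* : xy-node (t + t) ≡ y*
  xy-node-y* with suc s + t <? t | suc s + t <? suc t + s
  ... | yes lt | _ = ⊥-elim (m+n≮n (suc s) t lt)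
  ... | no _ | yes lt = ⊥-elim (<-irrefl (cong suc (+-comm s t)) lt)
  ... | no _ | no _ = refl

  data Stage : ℕ → Set where
    at-x* : Stage 0
    on-X  : ∀ {j} → j < t → Stage (suc j)
    on-Y  : ∀ {i} → i ≤ s → Stage (suc (t + i))
    at-y* : Stage (t + t)

  stage : ∀ {k} → k ≤ t + t → Stage k
  stage {zero} _ = at-x*
  stage {suc j} 1+j≤t+t with j <? t
  ... | yes j<t = on-X j<t
  ... | no j≮t with j ∸ t ≤? s
  ...   | yes i≤s = subst (Stage ∘ suc) (m+[n∸m]≡n (≮⇒≥ j≮t)) (on-Y i≤s)
  ...   | no i≰s = subst Stage t+t≡1+j at-y*
    where
    t+t≡1+j : t + t ≡ suc j
    t+t≡1+j = ≤-antisym (begin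
      t + t              ≡⟨ t+t≡2+t+s ⟩
      suc (suc t + s)    ≡⟨ cong suc (+-suc t s) ⟨
      suc (t + suc s)    ≤⟨ s≤s (+-monoʳ-≤ t (≰⇒> i≰s)) ⟩
      suc (t + (j ∸ t))  ≡⟨ cong suc (m+[n∸m]≡n (≮⇒≥ j≮t)) ⟩
      suc j              ∎) 1+j≤t+t
      where open ≤-Reasoning

  distX-xy : ∀ {k} → k ≤ t + t → distX (xy-node k) ≡ k
  distX-xy k≤t+t with stage k≤t+t
  ... | at-x* = refl
  ... | on-X {j} j<t rewrite xy-node-X j<t = cong suc (length-replicate j)
  ... | on-Y {i} i≤s rewrite xy-node-Y i≤s =
        cong (suc t +_) (subst (λ k → dist₀ k (zeros (s ∸ i)) ≡ i) (m∸n+n≡m i≤s) (dist₀-zeros (s ∸ i) i))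
  ... | at-y* rewrite xy-node-y* = refl

  XYEdge : ℕ → Set
  XYEdge k = ArcN t (xy-node k) (xy-node (suc k)) ⊎ ArcN t (xy-node (suc k)) (xy-node k)

  edge-via : ∀ k {u v} → xy-node k ≡ u → xy-node (suc k) ≡ v → ArcN t u v ⊎ ArcN t v u → XYEdge k
  edge-via _ refl refl e = e

  edge-along-X : ∀ {j} → j < t → Dec (suc j < t) → XYEdge (suc j)
  edge-along-X {j} j<t (yes 1+j<t) = edge-via (suc j) (xy-node-X j<t) (xy-node-X 1+j<t)
    (inj₁ (subst (ArcN t (X (zeros j)) ∘ X) (zeros-snoc j) (tx (zeros j) false)))
  edge-along-X j<t (no 1+j≮t) = subst (XYEdge ∘ suc) (≤-antisym (s≤s⁻¹ (≮⇒≥ 1+j≮t)) (s≤s⁻¹ j<t))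
    (edge-via (suc (suc s)) (xy-node-X ≤-refl)
      (trans (cong (xy-node ∘ suc) (sym (+-identityʳ t))) (xy-node-Y z≤n)) (inj₁ xy))

  edge-along-Y : ∀ {i} → i ≤ s → Dec (i < s) → XYEdge (suc (t + i))
  edge-along-Y {i} i≤s (yes i<s) =
    edge-via (suc (t + i)) (xy-node-Y i≤s) (trans (cong (xy-node ∘ suc) (sym (+-suc t i))) (xy-node-Y i<s))
      (inj₂ (subst (ArcN t (Y (zeros (s ∸ suc i))) ∘ Y)
              (trans (zeros-snoc _) (cong zeros (sym (+-∸-assoc 1 i<s)))) (ty _ false)))
  edge-along-Y i≤s (no i≮s) = subst (λ i → XYEdge (suc (t + i))) (≤-antisym (≮⇒≥ i≮s) i≤s)
    (edge-via (suc (t + s)) (trans (xy-node-Y ≤-refl) (cong (Y ∘ zeros) (n∸n≡0 s)))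
      (trans (cong xy-node (sym t+t≡2+t+s)) xy-node-y*) (inj₂ py))

  stage-edge : ∀ {k} → Stage k → k < t + t → XYEdge k
  stage-edge at-x* _ = edge-via 0 refl (xy-node-X (s≤s z≤n)) (inj₁ px)
  stage-edge (on-X {j} j<t) _ = edge-along-X j<t (suc j <? t)
  stage-edge (on-Y {i} i≤s) _ = edge-along-Y i≤s (i <? s)
  stage-edge at-y* t+t<t+t = ⊥-elim (<-irrefl refl t+t<t+t)

  xy-edge : ∀ {k} → k < t + t → XYEdge k
  xy-edge k<t+t = stage-edge (stage (<⇒≤ k<t+t)) k<t+t

  pinned-distX : ∀ n → T (pinnedN n) → distX n ≡ 0 ⊎ distX n ≡ t + t
  pinned-distX x* _ = inj₁ refl
  pinned-distX y* _ = inj₂ refl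
  pinned-distX z* _ = inj₂ refl

  xy-inner-unpinned : ∀ {k} → 0 < k → k < t + t → ¬ T (pinnedN (xy-node k))
  xy-inner-unpinned {k} 0<k k<t+t p with pinned-distX (xy-node k) p
  ... | inj₁ d = <-irrefl (trans (sym d) (distX-xy (<⇒≤ k<t+t))) 0<k
  ... | inj₂ d = <-irrefl (trans (sym (distX-xy (<⇒≤ k<t+t))) d) k<t+t

  xy-path : PinnedPath (t + t)
  xy-path = record
    { vertex         = λ k → xy-node k , xy-valid k
    ; start-pinned   = tt
    ; end-pinned     = subst (T ∘ pinnedN) (sym xy-node-y*) tt
    ; inner-unpinned = xy-inner-unpinned
    ; edge           = xy-edge
    ; injective      = λ i≤ j≤ e → trans (sym (distX-xy i≤)) (trans (cong distXᵛ e) (distX-xy j≤))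
    }

[t+t]+[t+t]≡4*t : ∀ t → (t + t) + (t + t) ≡ 4 * t
[t+t]+[t+t]≡4*t = solve 1 (λ t → (t :+ t) :+ (t :+ t) := con 4 :* t) refl
  where open +-*-Solver

2*[t+t]≡4*t : ∀ t → 2 * (t + t) ≡ 4 * t
2*[t+t]≡4*t = solve 1 (λ t → con 2 :* (t :+ t) := con 4 :* t) refl
  where open +-*-Solver

lemma7 : (t m : ℕ) → 2 ≤ t → 2 ≤ m → HasGirth (Derived.Adj (T4t t) m) (4 * t)
lemma7 (suc (suc s)) m@(suc (suc _)) (s≤s (s≤s z≤n)) (s≤s (s≤s z≤n)) =
  subst (HasCycleOfLength Adj) ([t+t]+[t+t]≡4*t t)
    (pinned-path-cycle (s≤s (s≤s z≤n)) fzero (fsuc fzero) (λ ()) xy-path) ,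
  λ k cycle → subst (_≤ k) (2*[t+t]≡4*t t)
    (girth-≥ distXᵛ distX-unit-steps distX-unique-descent pinned-are-leaves (t + t) pinned-separated k cycle)
  where
  open VoltageTree s
    using (t; distXᵛ; distX-unit-steps; distX-unique-descent; pinned-are-leaves; pinned-separated; xy-path)
  open ZeroVoltage (T4t t) m (λ _ → refl)
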